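{- Let $(\lambda,\mu)\in{\sf Kostka}_r^{\mathbb Z}$. For each $1\le i\le r$, the KGR graph $G(\lambda,\mu)$ has exactly $\mu^*_i$ sources in row $i$, and all of them are entries equal to $1$ in $A^*(\lambda,\mu)$.
   Context: ${\sf Kostka}_r^{\mathbb Z}$ is the set of pairs $(\lambda,\mu)$ of partitions with at most $r$ nonzero parts, $|\lambda|=|\mu|$, $\sum_{i\le t}\lambda_i\ge\sum_{i\le t}\mu_i$ for all $t$. $\lambda'$ is the conjugate partition; $\mu^*_i=\mu_i-\mu_{i+1}$ with $\mu_{r+1}:=0$. Canonical (Ryser) matrix $A(\lambda,\mu)$: let $s=\lambda_1$. Start with the $r\times s$ $\{0,1\}$-matrix whose row $i$ has $\mu_i$ ones in columns $1,\ldots,\mu_i$. For $j=s,s-1,\ldots,1$ in turn: looking only at columns $1,\ldots,j$ of the current matrix, choose $\lambda'_j$ rows, taking rows with the largest number of $1$'s in columns $1,\ldots,j$ and breaking ties by preferring rows further south; in each chosen row, move the rightmost $1$ among columns $1,\ldots,j$ to column $j$. The final matrix is $A(\lambda,\mu)$. Define $A^*(\lambda,\mu)_{i,j}=A(\lambda,\mu)_{i,j}-A(\lambda,\mu)_{i+1,j}$ (with $A(\lambda,\mu)_{r+1,j}:=0$). KGR graph $G(\lambda,\mu)$: directed graph whose vertices are the positions of the nonzero entries of $A^*(\lambda,\mu)$, with arcs (I) from each $-1$ entry to the rightmost $1$ entry strictly to its left in the same row, and (II) from each $1$ entry to the $-1$ entry in the same column, if one exists. A source is a vertex with no incoming arc.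 -}

module Defs where

open import Data.Nat using (ℕ; zero; suc; _+_; _∸_; _≤_; _<_; _≡ᵇ_; _<ᵇ_)
open import Data.Bool using (Bool; true; false; if_then_else_; _∧_; _∨_; not)
open import Data.Maybe using (Maybe; just; nothing)
open import Data.Vec using (Vec; []; _∷_)
import Data.Vec as Vec
open import Data.Integer using (ℤ; +_; -_; _-_; -[1+_])
open import Data.Sum using (_⊎_)
open import Data.Product using (_×_; _,_; Σ)
open import Relation.Binary.PropositionalEquality using (_≡_; _≢_)
open import Relation.Nullary using (¬_)

-- Conventions: everything is 1-based.  A partition with at most r
-- nonzero parts is a vector of length r (padded with zeros).
-- part v i = v_i for 1 ≤ i ≤ r, and 0 otherwise.

part : {r : ℕ} → Vec ℕ r → ℕ → ℕ
part []       _             = 0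
part (x ∷ xs) zero          = 0
part (x ∷ xs) (suc zero)    = x
part (x ∷ xs) (suc (suc i)) = part xs (suc i)

IsPartition : {r : ℕ} → Vec ℕ r → Set
IsPartition v = ∀ i → part v (suc (suc i)) ≤ part v (suc i)

psum : {r : ℕ} → Vec ℕ r → ℕ → ℕ
psum v zero    = 0
psum v (suc t) = psum v t + part v (suc t)

Kostka : (r : ℕ) → Vec ℕ r → Vec ℕ r → Set
Kostka r lam mu =
  IsPartition lam × IsPartition mu × Vec.sum lam ≡ Vec.sum mu ×
  (∀ t → psum mu t ≤ psum lam t)

starPart : {r : ℕ} → Vec ℕ r → ℕ → ℕ
starPart v i = part v i ∸ part v (suc i)

countUpTo : ℕ → (ℕ → Bool) → ℕ
countUpTo zero    P = 0
countUpTo (suc n) P = countUpTo n P + (if P (suc n) then 1 else 0)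

conj : {r : ℕ} → Vec ℕ r → ℕ → ℕ
conj {r} lam j = countUpTo r (λ i → j <ᵇ suc (part lam i))

-- Matrices: M i j, rows i and columns j 1-based.
Mat : Set
Mat = ℕ → ℕ → ℕ

inRange : ℕ → ℕ → Bool
inRange n i = (0 <ᵇ i) ∧ (i <ᵇ suc n)

initialMat : {r : ℕ} → Vec ℕ r → Mat
initialMat mu i j = if (0 <ᵇ j) ∧ (j <ᵇ suc (part mu i)) then 1 else 0

-- number of entries of row i in columns 1..j (all entries are 0/1)
rowCount : Mat → ℕ → ℕ → ℕ
rowCount M i zero    = 0
rowCount M i (suc j) = rowCount M i j + M i (suc j)

rightmost1 : Mat → ℕ → ℕ → Maybe ℕ
rightmost1 M i zero    = nothing
rightmost1 M i (suc j) = if M i (suc j) ≡ᵇ 1 then just (suc j) else rightmost1 M i j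

-- row i (1 ≤ i ≤ r) is chosen at stage j: its rank in the order
-- "more 1's in columns 1..j first, ties broken by preferring rows
-- further south" is < λ'_j.
chosen : (r : ℕ) → Vec ℕ r → Mat → ℕ → ℕ → Bool
chosen r lam M j i =
  inRange r i ∧
  (countUpTo r (λ k → (rowCount M i j <ᵇ rowCount M k j) ∨
                      ((rowCount M k j ≡ᵇ rowCount M i j) ∧ (i <ᵇ k)))
     <ᵇ conj lam j)

moveRow : Mat → ℕ → ℕ → (ℕ → ℕ)
moveRow M j i with rightmost1 M i j
... | nothing = M i
... | just p  = λ q → if q ≡ᵇ j then 1 else (if q ≡ᵇ p then 0 else M i q)

ryserStep : (r : ℕ) → Vec ℕ r → ℕ → Mat → Mat
ryserStep r lam j M i = if chosen r lam M j i then moveRow M j i else M i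

-- process j = n, n-1, …, 1
ryserLoop : (r : ℕ) → Vec ℕ r → ℕ → Mat → Mat
ryserLoop r lam zero    M = M
ryserLoop r lam (suc j) M = ryserLoop r lam j (ryserStep r lam (suc j) M)

ncols : {r : ℕ} → Vec ℕ r → ℕ
ncols lam = part lam 1

ryserMatrix : (r : ℕ) → Vec ℕ r → Vec ℕ r → Mat
ryserMatrix r lam mu = ryserLoop r lam (ncols lam) (initialMat mu)

Astar : (r : ℕ) → Vec ℕ r → Vec ℕ r → ℕ → ℕ → ℤ
Astar r lam mu i j =
  if i <ᵇ r then + A i j - + A (suc i) j else + A i j
  where A = ryserMatrix r lam mu

module KGR (r : ℕ) (lam mu : Vec ℕ r) where

  S : ℕ → ℕ → ℤ
  S = Astar r lam mu

  minusOne : ℤ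
  minusOne = -[1+ 0 ]

  Vertex : ℕ → ℕ → Set
  Vertex i j = (1 ≤ i) × (i ≤ r) × (1 ≤ j) × (j ≤ ncols lam) × (S i j ≢ + 0)

  ArcI : ℕ → ℕ → ℕ → ℕ → Set
  ArcI i j i' j' =
    (i' ≡ i) × (S i j ≡ minusOne) × (j' < j) × (S i j' ≡ + 1) ×
    (∀ k → j' < k → k < j → S i k ≢ + 1)

  ArcII : ℕ → ℕ → ℕ → ℕ → Set
  ArcII i j i' j' = (j' ≡ j) × (S i j ≡ + 1) × (S i' j ≡ minusOne)

  Arc : ℕ → ℕ → ℕ → ℕ → Set
  Arc i j i' j' = Vertex i j × Vertex i' j' × (ArcI i j i' j' ⊎ ArcII i j i' j')

  Source : ℕ → ℕ → Set
  Source i j = Vertex i j × (∀ i₀ j₀ → ¬ Arc i₀ j₀ i j)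

-- In the Ryser algorithm every row stays left-justified in the columns still to be processed,
-- and the rows moved at a column are those with the most ones there, ties going to the south.
-- Hence, in every column j of A, if row i has strictly more ones than row i+1 in columns 1,…,j
-- then a 1 of row i+1 at column j forces a 1 of row i, and if both rows have equally many ones
-- there then a 1 of row i forces a 1 of row i+1.  Reading row i of A* from left to right, the
-- +1 entries are then pushed on and the -1 entries popped off a stack whose height after
-- column n is the number of ones of row i minus that of row i+1 in columns 1,…,n (nonnegative
-- because it is so at the end, where it equals μ*_i).  A -1 occurs only when the stack holds
-- just the rightmost +1 to its left, which is its type (I) target; so the sources among the +1
-- entries are the μ*_i ones left on the stack.  A -1 entry is never a source: below it in its
-- column sits a run of ones of A whose lowest entry is a +1 of A*, with a type (II) arc to it.

module Submission where

open import Defs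
open import Data.Bool using (Bool; true; false; if_then_else_; _∧_; _∨_)
open import Data.Empty using (⊥-elim)
open import Data.Integer using (ℤ; +_; -[1+_]; _-_)
import Data.Integer.Properties as ℤ
open import Data.List using (List; []; _∷_; length)
open import Data.List.Membership.Propositional using (_∈_)
import Data.List.Relation.Unary.All as All
open import Data.List.Relation.Unary.Any using (here; there)
open import Data.List.Relation.Unary.AllPairs using ([]; _∷_)
open import Data.List.Relation.Unary.Unique.Propositional using (Unique)
open import Data.Maybe using (just; nothing)
open import Data.Nat using (ℕ; zero; suc; _+_; _∸_; _≤_; _<_; z≤n; s≤s; _⊓_; _≡ᵇ_; _<ᵇ_)
open import Data.Nat.Properties
open import Data.Product using (_×_; Σ; _,_; proj₁; proj₂)
open import Data.Sum using (_⊎_; inj₁; inj₂)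
open import Data.Vec using (Vec; []; _∷_)
open import Function.Bundles using (_⇔_; mk⇔; Equivalence)
open import Function.Construct.Composition using (_⇔-∘_)
open import Relation.Binary.PropositionalEquality
open import Relation.Nullary using (¬_; contradiction)
open import Relation.Nullary.Reflects
  using (Reflects; ofʸ; ofⁿ; _×-reflects_; _⊎-reflects_; fromEquivalence)

module _ {A : Set} {b : Bool} where

  reflects-true : Reflects A b → A → b ≡ true
  reflects-true (ofʸ _)  _ = refl
  reflects-true (ofⁿ ¬a) a = contradiction a ¬a

  reflects-false : Reflects A b → ¬ A → b ≡ false
  reflects-false (ofʸ a) ¬a = contradiction a ¬a
  reflects-false (ofⁿ _) _  = refl

  reflects-sound : Reflects A b → b ≡ true → A
  reflects-sound (ofʸ a) _ = a

  reflects-refute : Reflects A b → b ≡ false → ¬ A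
  reflects-refute (ofⁿ ¬a) _ = ¬a

≡ᵇ-reflects-≡ : ∀ m n → Reflects (m ≡ n) (m ≡ᵇ n)
≡ᵇ-reflects-≡ m n = fromEquivalence (≡ᵇ⇒≡ m n) (≡⇒≡ᵇ m n)

if-≡ᵇ-refl : ∀ {A : Set} p (x y : A) → (if p ≡ᵇ p then x else y) ≡ x
if-≡ᵇ-refl p x y = cong (if_then x else y) (reflects-true (≡ᵇ-reflects-≡ p p) refl)

if-≡ᵇ-≢ : ∀ {A : Set} {q p} (x y : A) → q ≢ p → (if q ≡ᵇ p then x else y) ≡ y
if-≡ᵇ-≢ {q = q} {p} x y q≢p = cong (if_then x else y) (reflects-false (≡ᵇ-reflects-≡ q p) q≢p)

indicator : Bool → ℕ
indicator b = if b then 1 else 0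

indicator-mono : ∀ {b c} → (b ≡ true → c ≡ true) → indicator b ≤ indicator c
indicator-mono {false}         _   = z≤n
indicator-mono {true}  {true}  _   = ≤-refl
indicator-mono {true}  {false} b⇒c with () ← b⇒c refl

countUpTo-mono : ∀ n {P Q : ℕ → Bool} → (∀ k → P k ≡ true → Q k ≡ true) →
                 countUpTo n P ≤ countUpTo n Q
countUpTo-mono zero    P⇒Q = z≤n
countUpTo-mono (suc n) P⇒Q = +-mono-≤ (countUpTo-mono n P⇒Q) (indicator-mono (P⇒Q (suc n)))

countUpTo-mono-< : ∀ n {P Q : ℕ → Bool} → (∀ k → P k ≡ true → Q k ≡ true) →
                   ∀ {l} → 1 ≤ l → l ≤ n → P l ≡ false → Q l ≡ true →
                   countUpTo n P < countUpTo n Q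
countUpTo-mono-< zero    P⇒Q 1≤l l≤0 = contradiction (≤-trans 1≤l l≤0) λ ()
countUpTo-mono-< (suc n) P⇒Q 1≤l l≤1+n Pl Ql with m≤n⇒m<n∨m≡n l≤1+n
... | inj₁ l≤n = +-mono-<-≤ (countUpTo-mono-< n P⇒Q 1≤l (≤-pred l≤n) Pl Ql)
                            (indicator-mono (P⇒Q (suc n)))
... | inj₂ refl rewrite Pl | Ql = +-mono-≤-< (countUpTo-mono n P⇒Q) ≤-refl

-- Ryser's algorithm

module Selection (r : ℕ) (lam : Vec ℕ r) where

  Precedes : Mat → ℕ → ℕ → ℕ → Set
  Precedes M J l i =
    rowCount M i J < rowCount M l J ⊎ (rowCount M l J ≡ rowCount M i J × i < l)

  precedes? : Mat → ℕ → ℕ → ℕ → Bool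
  precedes? M J l i =
    (rowCount M i J <ᵇ rowCount M l J) ∨ ((rowCount M l J ≡ᵇ rowCount M i J) ∧ (i <ᵇ l))

  precedes-reflects : ∀ M J l i → Reflects (Precedes M J l i) (precedes? M J l i)
  precedes-reflects M J l i =
    <ᵇ-reflects-< _ _ ⊎-reflects (≡ᵇ-reflects-≡ _ _ ×-reflects <ᵇ-reflects-< _ _)

  precedes-trans : ∀ {M J k l i} → Precedes M J k l → Precedes M J l i → Precedes M J k i
  precedes-trans (inj₁ l<k)        (inj₁ i<l)        = inj₁ (<-trans i<l l<k)
  precedes-trans (inj₁ l<k)        (inj₂ (l≡i , _))  = inj₁ (subst (_< _) l≡i l<k)
  precedes-trans (inj₂ (k≡l , _))  (inj₁ i<l)        = inj₁ (subst (_ <_) (sym k≡l) i<l)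
  precedes-trans (inj₂ (k≡l , l<k)) (inj₂ (l≡i , i<l)) = inj₂ (trans k≡l l≡i , <-trans i<l l<k)

  precedes-irrefl : ∀ {M J l} → ¬ Precedes M J l l
  precedes-irrefl (inj₁ l<l)       = <-irrefl refl l<l
  precedes-irrefl (inj₂ (_ , l<l)) = <-irrefl refl l<l

  rank : Mat → ℕ → ℕ → ℕ
  rank M J i = countUpTo r (λ l → precedes? M J l i)

  rank-< : ∀ {M J l i} → 1 ≤ l → l ≤ r → Precedes M J l i → rank M J l < rank M J i
  rank-< {M} {J} {l} {i} 1≤l l≤r l≺i =
    countUpTo-mono-< r
      (λ k k≺l → reflects-true (precedes-reflects M J k i)
                   (precedes-trans {M} {J} (reflects-sound (precedes-reflects M J k l) k≺l) l≺i))
      1≤l l≤r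
      (reflects-false (precedes-reflects M J l l) (precedes-irrefl {M} {J}))
      (reflects-true (precedes-reflects M J l i) l≺i)

  chosen-reflects : ∀ M J i →
    Reflects (((0 < i) × (i < suc r)) × rank M J i < conj lam J) (chosen r lam M J i)
  chosen-reflects M J i =
    (<ᵇ-reflects-< 0 i ×-reflects <ᵇ-reflects-< i (suc r)) ×-reflects <ᵇ-reflects-< _ _

  chosen⇒≤r : ∀ {M J i} → chosen r lam M J i ≡ true → i ≤ r
  chosen⇒≤r {M} {J} {i} ch = ≤-pred (proj₂ (proj₁ (reflects-sound (chosen-reflects M J i) ch)))

  chosen-preceded : ∀ {M J l i} → 1 ≤ l → l ≤ r → Precedes M J l i →
                    chosen r lam M J i ≡ true → chosen r lam M J l ≡ true
  chosen-preceded {M} {J} {l} {i} 1≤l l≤r l≺i ch =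
    reflects-true (chosen-reflects M J l)
      ((1≤l , s≤s l≤r) ,
       <-trans (rank-< {M} {J} 1≤l l≤r l≺i) (proj₂ (reflects-sound (chosen-reflects M J i) ch)))

record LeftJustified (M : Mat) (i n c : ℕ) : Set where
  field
    ones  : ∀ {q} → 1 ≤ q → q ≤ c → q ≤ n → M i q ≡ 1
    zeros : ∀ {q} → c < q → q ≤ n → M i q ≡ 0

open LeftJustified

leftJustified-restrict : ∀ {M i n c} → LeftJustified M i (suc n) c → LeftJustified M i n c
leftJustified-restrict lj = record
  { ones  = λ 1≤q q≤c q≤n → ones lj 1≤q q≤c (m≤n⇒m≤1+n q≤n)
  ; zeros = λ c<q q≤n → zeros lj c<q (m≤n⇒m≤1+n q≤n)
  }

rowCount-leftJustified : ∀ {M i n c} → LeftJustified M i n c → rowCount M i n ≡ n ⊓ c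
rowCount-leftJustified {n = zero}          lj = refl
rowCount-leftJustified {n = suc n} {c} lj with ≤-<-connex (suc n) c
... | inj₁ 1+n≤c rewrite rowCount-leftJustified (leftJustified-restrict lj)
                       | ones lj (s≤s z≤n) 1+n≤c ≤-refl
                       | m≤n⇒m⊓n≡m (≤-trans (n≤1+n n) 1+n≤c) | m≤n⇒m⊓n≡m 1+n≤c = +-comm n 1
... | inj₂ c<1+n rewrite rowCount-leftJustified (leftJustified-restrict lj)
                       | zeros lj c<1+n ≤-refl
                       | m≥n⇒m⊓n≡n (≤-pred c<1+n) | m≥n⇒m⊓n≡n (<⇒≤ c<1+n) = +-identityʳ c

rowCount-full : ∀ {M i n c} → c ≤ n → LeftJustified M i n c → rowCount M i n ≡ c
rowCount-full c≤n lj = trans (rowCount-leftJustified lj) (m≥n⇒m⊓n≡n c≤n)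

rightmost1-empty : ∀ {M i n} → LeftJustified M i n 0 → rightmost1 M i n ≡ nothing
rightmost1-empty {n = zero}  lj = refl
rightmost1-empty {n = suc n} lj rewrite zeros lj (s≤s z≤n) ≤-refl =
  rightmost1-empty (leftJustified-restrict lj)

rightmost1-leftJustified : ∀ {M i n c} → suc c ≤ n → LeftJustified M i n (suc c) →
                           rightmost1 M i n ≡ just (suc c)
rightmost1-leftJustified {n = suc n} c<1+n lj with m≤n⇒m<n∨m≡n c<1+n
... | inj₂ refl rewrite ones lj (s≤s z≤n) ≤-refl ≤-refl = refl
... | inj₁ c<n  rewrite zeros lj c<n ≤-refl =
  rightmost1-leftJustified (≤-pred c<n) (leftJustified-restrict lj)

moveRow-nothing : ∀ {M j i} → rightmost1 M i j ≡ nothing → ∀ q → moveRow M j i q ≡ M i q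
moveRow-nothing {M} {j} {i} none q with rightmost1 M i j
... | nothing = refl

moveRow-just : ∀ {M j i p} → rightmost1 M i j ≡ just p →
               ∀ q → moveRow M j i q ≡ (if q ≡ᵇ j then 1 else (if q ≡ᵇ p then 0 else M i q))
moveRow-just {M} {j} {i} some q with rightmost1 M i j
... | just p with refl ← some = refl

leftJustified-cong : ∀ {M N i n c} → (∀ q → N i q ≡ M i q) →
                     LeftJustified M i n c → LeftJustified N i n c
leftJustified-cong N≗M lj = record
  { ones  = λ {q} 1≤q q≤c q≤n → trans (N≗M q) (ones lj 1≤q q≤c q≤n)
  ; zeros = λ {q} c<q q≤n → trans (N≗M q) (zeros lj c<q q≤n)
  }

leftJustified-cap : ∀ {M i n c} → n ≤ c → LeftJustified M i n c → LeftJustified M i n n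
leftJustified-cap n≤c lj = record
  { ones  = λ 1≤q q≤n → ones lj 1≤q (≤-trans q≤n n≤c)
  ; zeros = λ n<q q≤n → contradiction q≤n (<⇒≱ n<q)
  }

Binary : ℕ → Set
Binary x = x ≡ 0 ⊎ x ≡ 1

-- x is a column of a 0/1 matrix and c i the number of ones of row i up to and including that column
record ColumnRules (r : ℕ) (x c : ℕ → ℕ) : Set where
  field
    binary           : ∀ i → Binary (x i)
    outside-zero     : ∀ {i} → r < i → x i ≡ 0
    ahead-lifts-one  : ∀ {i} → 1 ≤ i → c (suc i) < c i → x (suc i) ≡ 1 → x i ≡ 1
    level-lowers-one : ∀ {i} → c i ≡ c (suc i) → x i ≡ 1 → x (suc i) ≡ 1

open ColumnRules

columnRules-cong : ∀ {r x x′ c c′} → (∀ i → x i ≡ x′ i) → (∀ i → c i ≡ c′ i) →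
                   ColumnRules r x c → ColumnRules r x′ c′
columnRules-cong {x = x} {x′} {c} {c′} x≗x′ c≗c′ rules = record
  { binary           = λ i → subst Binary (x≗x′ i) (binary rules i)
  ; outside-zero     = λ {i} r<i → trans (sym (x≗x′ i)) (outside-zero rules r<i)
  ; ahead-lifts-one  = λ {i} 1≤i c<c x≡1 → trans (sym (x≗x′ i)) (ahead-lifts-one rules 1≤i
                         (subst₂ _<_ (sym (c≗c′ (suc i))) (sym (c≗c′ i)) c<c) (trans (x≗x′ (suc i)) x≡1))
  ; level-lowers-one = λ {i} c≡c x≡1 → trans (sym (x≗x′ (suc i))) (level-lowers-one rules
                         (trans (c≗c′ i) (trans c≡c (sym (c≗c′ (suc i))))) (trans (x≗x′ i) x≡1))
  }

module RyserStep (r : ℕ) (lam : Vec ℕ r) where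
  open Selection r lam

  ryserStep-unchosen : ∀ {M J i} → chosen r lam M J i ≡ false →
                       ∀ q → ryserStep r lam J M i q ≡ M i q
  ryserStep-unchosen {M} {J} {i} ch q = cong (λ b → (if b then moveRow M J i else M i) q) ch

  ryserStep-chosen : ∀ {M J i} → chosen r lam M J i ≡ true →
                     ∀ q → ryserStep r lam J M i q ≡ moveRow M J i q
  ryserStep-chosen {M} {J} {i} ch q = cong (λ b → (if b then moveRow M J i else M i) q) ch

  -- row i of M holds c left-justified ones in columns 1,…,suc k; N is M after the step at column suc k
  record RowStep (M N : Mat) (k i c : ℕ) : Set where
    field
      new-binary      : Binary (N i (suc k))
      new≤count       : N i (suc k) ≤ c
      rest-justified  : LeftJustified N i k (c ∸ N i (suc k))
      right-unchanged : ∀ {q} → suc k < q → N i q ≡ M i q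
      new-one⇒        : N i (suc k) ≡ 1 → (chosen r lam M (suc k) i ≡ true × 1 ≤ c) ⊎ c ≡ suc k
      chosen⇒new-one  : chosen r lam M (suc k) i ≡ true → 1 ≤ c → N i (suc k) ≡ 1
      full⇒new-one    : c ≡ suc k → N i (suc k) ≡ 1

  rowStep-idle : ∀ {M N k i c} → (∀ q → N i q ≡ M i q) →
                 (chosen r lam M (suc k) i ≡ true → c ≡ 0) →
                 c ≤ suc k → LeftJustified M i (suc k) c → RowStep M N k i c
  rowStep-idle {M} {N} {k} {i} {c} N≗M idle c≤1+k lj with m≤n⇒m<n∨m≡n c≤1+k
  ... | inj₁ c<1+k = record
    { new-binary      = inj₁ new≡0
    ; new≤count       = subst (_≤ c) (sym new≡0) z≤n
    ; rest-justified  = subst (λ x → LeftJustified N i k (c ∸ x)) (sym new≡0)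
                          (leftJustified-cong N≗M (leftJustified-restrict lj))
    ; right-unchanged = λ {q} _ → N≗M q
    ; new-one⇒        = λ new≡1 → contradiction (trans (sym new≡0) new≡1) λ ()
    ; chosen⇒new-one  = λ ch 1≤c → contradiction (subst (1 ≤_) (idle ch) 1≤c) λ ()
    ; full⇒new-one    = λ c≡1+k → contradiction c≡1+k (<⇒≢ c<1+k)
    }
    where
    new≡0 : N i (suc k) ≡ 0
    new≡0 = trans (N≗M (suc k)) (zeros lj c<1+k ≤-refl)
  ... | inj₂ refl = record
    { new-binary      = inj₂ new≡1
    ; new≤count       = subst (_≤ suc k) (sym new≡1) (s≤s z≤n)
    ; rest-justified  = subst (λ x → LeftJustified N i k (suc k ∸ x)) (sym new≡1)
                          (leftJustified-cong N≗M (leftJustified-cap (n≤1+n k) (leftJustified-restrict lj)))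
    ; right-unchanged = λ {q} _ → N≗M q
    ; new-one⇒        = λ _ → inj₂ refl
    ; chosen⇒new-one  = λ _ _ → new≡1
    ; full⇒new-one    = λ _ → new≡1
    }
    where
    new≡1 : N i (suc k) ≡ 1
    new≡1 = trans (N≗M (suc k)) (ones lj (s≤s z≤n) ≤-refl ≤-refl)

  rowStep-move : ∀ {M N k i c} →
                 (∀ q → N i q ≡ (if q ≡ᵇ suc k then 1 else (if q ≡ᵇ suc c then 0 else M i q))) →
                 chosen r lam M (suc k) i ≡ true →
                 suc c ≤ suc k → LeftJustified M i (suc k) (suc c) → RowStep M N k i (suc c)
  rowStep-move {M} {N} {k} {i} {c} N≗ ch c<1+k lj = record
    { new-binary      = inj₂ new≡1
    ; new≤count       = subst (_≤ suc c) (sym new≡1) (s≤s z≤n)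
    ; rest-justified  = subst (λ x → LeftJustified N i k (suc c ∸ x)) (sym new≡1) rest
    ; right-unchanged = λ {q} 1+k<q → trans (N≗ q) (trans (if-≡ᵇ-≢ 1 _ (>⇒≢ 1+k<q))
                          (if-≡ᵇ-≢ 0 _ (>⇒≢ (<-≤-trans (s≤s c<1+k) 1+k<q))))
    ; new-one⇒        = λ _ → inj₁ (ch , s≤s z≤n)
    ; chosen⇒new-one  = λ _ _ → new≡1
    ; full⇒new-one    = λ _ → new≡1
    }
    where
    new≡1 : N i (suc k) ≡ 1
    new≡1 = trans (N≗ (suc k)) (if-≡ᵇ-refl (suc k) 1 _)

    vacated : ∀ {q} → c < q → q ≤ suc k → (if q ≡ᵇ suc c then 0 else M i q) ≡ 0
    vacated {q} c<q q≤1+k with m≤n⇒m<n∨m≡n c<q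
    ... | inj₂ refl  = if-≡ᵇ-refl (suc c) 0 _
    ... | inj₁ 1+c<q = trans (if-≡ᵇ-≢ 0 _ (>⇒≢ 1+c<q)) (zeros lj 1+c<q q≤1+k)

    rest : LeftJustified N i k c
    rest = record
      { ones  = λ {q} 1≤q q≤c q≤k → trans (N≗ q) (trans (if-≡ᵇ-≢ 1 _ (<⇒≢ (s≤s q≤k)))
                  (trans (if-≡ᵇ-≢ 0 _ (<⇒≢ (s≤s q≤c)))
                         (ones lj 1≤q (m≤n⇒m≤1+n q≤c) (m≤n⇒m≤1+n q≤k))))
      ; zeros = λ {q} c<q q≤k → trans (N≗ q) (trans (if-≡ᵇ-≢ 1 _ (<⇒≢ (s≤s q≤k)))
                  (vacated c<q (m≤n⇒m≤1+n q≤k)))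
      }

  rowStep : ∀ {M k i c} → c ≤ suc k → LeftJustified M i (suc k) c →
            RowStep M (ryserStep r lam (suc k) M) k i c
  rowStep {M} {k} {i} {c} c≤1+k lj with chosen r lam M (suc k) i in ch
  ... | false = rowStep-idle (ryserStep-unchosen {M} {suc k} ch)
                  (λ ch′ → contradiction (trans (sym ch) ch′) λ ()) c≤1+k lj
  rowStep {M} {k} {i} {zero}  c≤1+k lj | true = rowStep-idle
    (λ q → trans (ryserStep-chosen {M} {suc k} ch q)
                 (moveRow-nothing {M} {suc k} {i} (rightmost1-empty lj) q))
    (λ _ → refl) c≤1+k lj
  rowStep {M} {k} {i} {suc c} c≤1+k lj | true = rowStep-move
    (λ q → trans (ryserStep-chosen {M} {suc k} ch q)
                 (moveRow-just {M} {suc k} {i} (rightmost1-leftJustified c≤1+k lj) q))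
    ch c≤1+k lj

  record Justified (k : ℕ) (M : Mat) (i : ℕ) : Set where
    field
      count         : ℕ
      count≤        : count ≤ k
      justified     : LeftJustified M i k count
      outside-empty : r < i → count ≡ 0

  open Justified

  module ColumnStep (k : ℕ) (M : Mat) (rows : ∀ i → Justified (suc k) M i) where

    N : Mat
    N = ryserStep r lam (suc k) M

    c new : ℕ → ℕ
    c i   = count (rows i)
    new i = N i (suc k)

    step : ∀ i → RowStep M N k i (c i)
    step i = rowStep (count≤ (rows i)) (justified (rows i))

    open RowStep

    count-before : ∀ i → rowCount M i (suc k) ≡ c i
    count-before i = rowCount-full (count≤ (rows i)) (justified (rows i))

    rest≤k : ∀ i → c i ∸ new i ≤ k
    rest≤k i with new-binary (step i) | m≤n⇒m<n∨m≡n (count≤ (rows i))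
    ... | inj₂ new≡1 | _          rewrite new≡1 = ∸-monoˡ-≤ 1 (count≤ (rows i))
    ... | inj₁ new≡0 | inj₁ c<1+k rewrite new≡0 = ≤-pred c<1+k
    ... | inj₁ new≡0 | inj₂ c≡1+k = contradiction (trans (sym new≡0) (full⇒new-one (step i) c≡1+k)) λ ()

    justified-after : ∀ i → Justified k N i
    justified-after i = record
      { count         = c i ∸ new i
      ; count≤        = rest≤k i
      ; justified     = rest-justified (step i)
      ; outside-empty = λ r<i → trans (cong (_∸ new i) (outside-empty (rows i) r<i)) (0∸n≡0 (new i))
      }

    count-after : ∀ i → rowCount N i k + new i ≡ c i
    count-after i = trans (cong (_+ new i) (rowCount-full (rest≤k i) (rest-justified (step i))))
                          (m∸n+n≡m (new≤count (step i)))

    new-outside : ∀ {i} → r < i → new i ≡ 0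
    new-outside {i} r<i with new-binary (step i)
    ... | inj₁ new≡0 = new≡0
    ... | inj₂ new≡1 with new-one⇒ (step i) new≡1
    ...   | inj₁ (ch , _) = contradiction (chosen⇒≤r {M} {suc k} ch) (<⇒≱ r<i)
    ...   | inj₂ c≡1+k    = contradiction (trans (sym (outside-empty (rows i) r<i)) c≡1+k) λ ()

    -- a row with more ones than the chosen row below it precedes it, hence is chosen too
    new-ahead : ∀ {i} → 1 ≤ i → c (suc i) < c i → new (suc i) ≡ 1 → new i ≡ 1
    new-ahead {i} 1≤i c′<c new′≡1 with new-one⇒ (step (suc i)) new′≡1
    ... | inj₂ c′≡1+k   = contradiction (count≤ (rows i)) (<⇒≱ (subst (_< c i) c′≡1+k c′<c))
    ... | inj₁ (ch , _) = chosen⇒new-one (step i)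
      (chosen-preceded 1≤i (<⇒≤ (chosen⇒≤r {M} {suc k} ch))
        (inj₁ (subst₂ _<_ (sym (count-before (suc i))) (sym (count-before i)) c′<c)) ch)
      (≤-trans (s≤s z≤n) c′<c)

    -- ties are broken in favour of the southern row
    new-level : ∀ {i} → c i ≡ c (suc i) → new i ≡ 1 → new (suc i) ≡ 1
    new-level {i} c≡c′ new≡1 with new-one⇒ (step i) new≡1
    ... | inj₂ c≡1+k     = full⇒new-one (step (suc i)) (trans (sym c≡c′) c≡1+k)
    ... | inj₁ (ch , 1≤c) with ≤-<-connex (suc i) r
    ...   | inj₂ r<1+i = contradiction (trans c≡c′ (outside-empty (rows (suc i)) r<1+i)) (>⇒≢ 1≤c)
    ...   | inj₁ 1+i≤r = chosen⇒new-one (step (suc i))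
      (chosen-preceded (s≤s z≤n) 1+i≤r
        (inj₂ (trans (count-before (suc i)) (trans (sym c≡c′) (sym (count-before i))) , n<1+n i)) ch)
      (subst (1 ≤_) c≡c′ 1≤c)

    new-rules : ColumnRules r new c
    new-rules = record
      { binary           = λ i → new-binary (step i)
      ; outside-zero     = new-outside
      ; ahead-lifts-one  = new-ahead
      ; level-lowers-one = new-level
      }

  record LoopResult (k : ℕ) (M F : Mat) : Set where
    field
      right-unchanged : ∀ i {q} → k < q → F i q ≡ M i q
      count-preserved : ∀ i → rowCount F i k ≡ rowCount M i k
      rules           : ∀ {j} → 1 ≤ j → j ≤ k → ColumnRules r (λ i → F i j) (λ i → rowCount F i j)

  ryserLoop-result : ∀ k M → (∀ i → Justified k M i) → LoopResult k M (ryserLoop r lam k M)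
  ryserLoop-result zero    M _    = record
    { right-unchanged = λ _ _ → refl
    ; count-preserved = λ _ → refl
    ; rules           = λ 1≤j j≤0 → contradiction (≤-trans 1≤j j≤0) λ ()
    }
  ryserLoop-result (suc k) M rows = record
    { right-unchanged = λ i 1+k<q → trans (LoopResult.right-unchanged IH i (<-trans (n<1+n k) 1+k<q))
                                          (RowStep.right-unchanged (step i) 1+k<q)
    ; count-preserved = λ i → trans (count-final i) (sym (count-before i))
    ; rules           = rules
    }
    where
    open ColumnStep k M rows

    F : Mat
    F = ryserLoop r lam k N

    IH : LoopResult k N F
    IH = ryserLoop-result k N justified-after

    column-final : ∀ i → new i ≡ F i (suc k)
    column-final i = sym (LoopResult.right-unchanged IH i (n<1+n k))

    count-final : ∀ i → rowCount F i (suc k) ≡ c i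
    count-final i = trans (cong₂ _+_ (LoopResult.count-preserved IH i) (sym (column-final i)))
                          (count-after i)

    rules : ∀ {j} → 1 ≤ j → j ≤ suc k → ColumnRules r (λ i → F i j) (λ i → rowCount F i j)
    rules 1≤j j≤1+k with m≤n⇒m<n∨m≡n j≤1+k
    ... | inj₁ j≤k  = LoopResult.rules IH 1≤j (≤-pred j≤k)
    ... | inj₂ refl = columnRules-cong column-final (λ i → sym (count-final i)) new-rules

-- Two consecutive rows of the canonical matrix

-1ℤ : ℤ
-1ℤ = -[1+ 0 ]

module TwoRows (r : ℕ) (F : Mat) (i s : ℕ) (1≤i : 1 ≤ i) (e : ℕ → ℤ)
  (e-def : ∀ {j} → 1 ≤ j → j ≤ s → e j ≡ + F i j - + F (suc i) j)
  (rules : ∀ {j} → 1 ≤ j → j ≤ s → ColumnRules r (λ i → F i j) (λ i → rowCount F i j))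
  (dominant : rowCount F (suc i) s ≤ rowCount F i s) where

  above below gap : ℕ → ℕ
  above = rowCount F i
  below = rowCount F (suc i)
  gap n = above n ∸ below n

  data Column (j : ℕ) : Set where
    plus  : F i j ≡ 1 → F (suc i) j ≡ 0 → e j ≡ + 1 → Column j
    minus : F i j ≡ 0 → F (suc i) j ≡ 1 → e j ≡ -1ℤ → Column j
    flat  : F i j ≡ F (suc i) j → e j ≡ + 0 → Column j

  column : ∀ {j} → 1 ≤ j → j ≤ s → Column j
  column 1≤j j≤s with binary (rules 1≤j j≤s) i | binary (rules 1≤j j≤s) (suc i) | e-def 1≤j j≤s
  ... | inj₁ a | inj₁ b | ej = flat  (trans a (sym b)) (trans ej (cong₂ (λ x y → + x - + y) a b))
  ... | inj₁ a | inj₂ b | ej = minus a b               (trans ej (cong₂ (λ x y → + x - + y) a b))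
  ... | inj₂ a | inj₁ b | ej = plus  a b               (trans ej (cong₂ (λ x y → + x - + y) a b))
  ... | inj₂ a | inj₂ b | ej = flat  (trans a (sym b)) (trans ej (cong₂ (λ x y → + x - + y) a b))

  plus⇒ahead : ∀ {j} → 1 ≤ j → j ≤ s → F i j ≡ 1 → F (suc i) j ≡ 0 →
               below j ≤ above j → below j < above j
  plus⇒ahead 1≤j j≤s a b below≤above = ≤∧≢⇒< below≤above λ below≡above →
    contradiction (trans (sym b) (level-lowers-one (rules 1≤j j≤s) (sym below≡above) a)) λ ()

  minus⇒level : ∀ {j} → 1 ≤ j → j ≤ s → F i j ≡ 0 → F (suc i) j ≡ 1 →
                below j ≤ above j → above j ≡ below j
  minus⇒level 1≤j j≤s a b below≤above = ≤-antisym (≮⇒≥ λ below<above →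
    contradiction (trans (sym a) (ahead-lifts-one (rules 1≤j j≤s) 1≤i below<above b)) λ ()) below≤above

  -- the prefix dominance is only known at the end, so it is propagated leftwards
  dominance-step : ∀ {n} → suc n ≤ s → below (suc n) ≤ above (suc n) → below n ≤ above n
  dominance-step {n} 1+n≤s below≤above with column (s≤s z≤n) 1+n≤s
  ... | plus a b _ with plus⇒ahead (s≤s z≤n) 1+n≤s a b below≤above
  ...   | below<above rewrite a | b | +-identityʳ (below n) | +-comm (above n) 1 = ≤-pred below<above
  dominance-step {n} 1+n≤s below≤above | minus a b _ rewrite a | b | +-identityʳ (above n)
    | +-comm (below n) 1 = ≤-trans (n≤1+n _) below≤above
  dominance-step {n} 1+n≤s below≤above | flat a _ rewrite a = +-cancelʳ-≤ _ _ _ below≤above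

  dominance-from : ∀ k {n} → n + k ≡ s → below n ≤ above n
  dominance-from zero    {n} n+0≡s rewrite +-identityʳ n | n+0≡s = dominant
  dominance-from (suc k) {n} n+1+k≡s =
    dominance-step (subst (suc n ≤_) 1+n+k≡s (m≤m+n (suc n) k)) (dominance-from k 1+n+k≡s)
    where
    1+n+k≡s : suc n + k ≡ s
    1+n+k≡s = trans (sym (+-suc n k)) n+1+k≡s

  dominance : ∀ {n} → n ≤ s → below n ≤ above n
  dominance {n} n≤s = dominance-from (s ∸ n) {n} (m+[n∸m]≡n n≤s)

  gap-plus : ∀ {n} → n ≤ s → F i (suc n) ≡ 1 → F (suc i) (suc n) ≡ 0 → gap (suc n) ≡ suc (gap n)
  gap-plus {n} n≤s a b = begin
    (above n + F i (suc n)) ∸ (below n + F (suc i) (suc n))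
      ≡⟨ cong₂ (λ x y → (above n + x) ∸ (below n + y)) a b ⟩
    (above n + 1) ∸ (below n + 0)  ≡⟨ cong₂ _∸_ (+-comm (above n) 1) (+-identityʳ (below n)) ⟩
    suc (above n) ∸ below n        ≡⟨ +-∸-assoc 1 (dominance n≤s) ⟩
    suc (gap n)                    ∎
    where open ≡-Reasoning

  gap-flat : ∀ {n} → F i (suc n) ≡ F (suc i) (suc n) → gap (suc n) ≡ gap n
  gap-flat {n} a rewrite a | +-comm (above n) (F (suc i) (suc n)) | +-comm (below n) (F (suc i) (suc n)) =
    [m+n]∸[m+o]≡n∸o (F (suc i) (suc n)) (above n) (below n)

  gap-minus : ∀ {n} → suc n ≤ s → F i (suc n) ≡ 0 → F (suc i) (suc n) ≡ 1 →
              gap n ≡ 1 × gap (suc n) ≡ 0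
  gap-minus {n} 1+n≤s a b = before , trans (cong (_∸ below (suc n)) level) (n∸n≡0 (below (suc n)))
    where
    level : above (suc n) ≡ below (suc n)
    level = minus⇒level (s≤s z≤n) 1+n≤s a b (dominance 1+n≤s)

    before : gap n ≡ 1
    before = begin
      above n ∸ below n        ≡⟨ cong (_∸ below n) (sym (+-identityʳ (above n))) ⟩
      above n + 0 ∸ below n    ≡⟨ cong (λ x → above n + x ∸ below n) (sym a) ⟩
      above (suc n) ∸ below n  ≡⟨ cong (_∸ below n) level ⟩
      below n + F (suc i) (suc n) ∸ below n ≡⟨ m+n∸m≡n (below n) _ ⟩
      F (suc i) (suc n)        ≡⟨ b ⟩
      1                        ∎
      where open ≡-Reasoning

  RightmostPlus : ℕ → ℕ → Set
  RightmostPlus n h = 1 ≤ h × h ≤ n × e h ≡ + 1 × (∀ k → h < k → k ≤ n → e k ≢ + 1)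

  -- j is the target of a type (I) arc from a minus entry in columns 1,…,n
  Cancelled : ℕ → ℕ → Set
  Cancelled n j = Σ ℕ λ j₀ → j₀ ≤ n × e j₀ ≡ -1ℤ × j < j₀ × (∀ k → j < k → k < j₀ → e k ≢ + 1)

  Surviving : ℕ → ℕ → Set
  Surviving n j = 1 ≤ j × j ≤ n × e j ≡ + 1 × ¬ Cancelled n j

  surviving-restrict : ∀ {n j} → Surviving (suc n) j → j ≤ n → Surviving n j
  surviving-restrict (1≤j , _ , ej , uncancelled) j≤n = 1≤j , j≤n , ej ,
    λ (j₀ , j₀≤n , rest) → uncancelled (j₀ , m≤n⇒m≤1+n j₀≤n , rest)

  surviving-extend : ∀ {n j} → Surviving n j →
                     (e (suc n) ≡ -1ℤ → Σ ℕ λ k → j < k × k ≤ n × e k ≡ + 1) → Surviving (suc n) j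
  surviving-extend {n} {j} (1≤j , j≤n , ej , uncancelled) shielded =
    1≤j , m≤n⇒m≤1+n j≤n , ej , uncancelled′
    where
    uncancelled′ : ¬ Cancelled (suc n) j
    uncancelled′ (j₀ , j₀≤1+n , e₀ , j<j₀ , clear) with m≤n⇒m<n∨m≡n j₀≤1+n
    ... | inj₁ j₀≤n = uncancelled (j₀ , ≤-pred j₀≤n , e₀ , j<j₀ , clear)
    ... | inj₂ refl with shielded e₀
    ...   | k , j<k , k≤n , ek = clear k j<k (s≤s k≤n) ek

  rightmostPlus-extend : ∀ {n h} → RightmostPlus n h → e (suc n) ≢ + 1 → RightmostPlus (suc n) h
  rightmostPlus-extend (1≤h , h≤n , eh , last) e′≢1 = 1≤h , m≤n⇒m≤1+n h≤n , eh , last′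
    where
    last′ : ∀ k → _ < k → k ≤ _ → e k ≢ + 1
    last′ k h<k k≤1+n with m≤n⇒m<n∨m≡n k≤1+n
    ... | inj₁ k≤n  = last k h<k (≤-pred k≤n)
    ... | inj₂ refl = e′≢1

  -- the surviving plus entries of columns 1,…,n behave like a stack of height gap n
  record Survivors (n : ℕ) : Set where
    field
      list       : List ℕ
      unique     : Unique list
      complete   : ∀ j → j ∈ list ⇔ Surviving n j
      length≡gap : length list ≡ gap n
      top        : 0 < gap n → Σ ℕ λ h → Σ (List ℕ) λ t → list ≡ h ∷ t × RightmostPlus n h

  open Survivors

  survivors-zero : Survivors 0
  survivors-zero = record
    { list       = []
    ; unique     = []
    ; complete   = λ j → mk⇔ (λ ()) λ (1≤j , j≤0 , _) → contradiction (≤-trans 1≤j j≤0) λ ()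
    ; length≡gap = refl
    ; top        = λ ()
    }

  survivors-plus : ∀ {n} → suc n ≤ s → F i (suc n) ≡ 1 → F (suc i) (suc n) ≡ 0 → e (suc n) ≡ + 1 →
                   Survivors n → Survivors (suc n)
  survivors-plus {n} 1+n≤s a b e′ S = record
    { list       = suc n ∷ list S
    ; unique     = All.tabulate (λ j∈ → >⇒≢ (s≤s (member≤n j∈))) ∷ unique S
    ; complete   = λ j → mk⇔ to (from j)
    ; length≡gap = trans (cong suc (length≡gap S)) (sym (gap-plus (<⇒≤ 1+n≤s) a b))
    ; top        = λ _ → suc n , list S , refl , newest
    }
    where
    member≤n : ∀ {j} → j ∈ list S → j ≤ n
    member≤n j∈ = proj₁ (proj₂ (Equivalence.to (complete S _) j∈))

    newest : RightmostPlus (suc n) (suc n)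
    newest = s≤s z≤n , ≤-refl , e′ , λ k 1+n<k k≤1+n → contradiction k≤1+n (<⇒≱ 1+n<k)

    to : ∀ {j} → j ∈ suc n ∷ list S → Surviving (suc n) j
    to (here refl) = s≤s z≤n , ≤-refl , e′ , λ (j₀ , j₀≤1+n , _ , 1+n<j₀ , _) → <⇒≱ 1+n<j₀ j₀≤1+n
    to (there j∈)  = surviving-extend (Equivalence.to (complete S _) j∈)
                       (λ e′≡-1 → contradiction (trans (sym e′) e′≡-1) λ ())

    from : ∀ j → Surviving (suc n) j → j ∈ suc n ∷ list S
    from j sv with m≤n⇒m<n∨m≡n (proj₁ (proj₂ sv))
    ... | inj₂ refl  = here refl
    ... | inj₁ j<1+n = there (Equivalence.from (complete S j) (surviving-restrict sv (≤-pred j<1+n)))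

  survivors-flat : ∀ {n} → F i (suc n) ≡ F (suc i) (suc n) → e (suc n) ≡ + 0 →
                   Survivors n → Survivors (suc n)
  survivors-flat {n} a e′ S = record
    { list       = list S
    ; unique     = unique S
    ; complete   = λ j → mk⇔ to (from j)
    ; length≡gap = trans (length≡gap S) (sym (gap-flat a))
    ; top        = λ 0<gap → extend-top (top S (subst (0 <_) (gap-flat a) 0<gap))
    }
    where
    to : ∀ {j} → j ∈ list S → Surviving (suc n) j
    to j∈ = surviving-extend (Equivalence.to (complete S _) j∈)
              (λ e′≡-1 → contradiction (trans (sym e′) e′≡-1) λ ())

    from : ∀ j → Surviving (suc n) j → j ∈ list S
    from j sv with m≤n⇒m<n∨m≡n (proj₁ (proj₂ sv))
    ... | inj₂ refl  = contradiction (trans (sym e′) (proj₁ (proj₂ (proj₂ sv)))) λ ()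
    ... | inj₁ j<1+n = Equivalence.from (complete S j) (surviving-restrict sv (≤-pred j<1+n))

    extend-top : (Σ ℕ λ h → Σ (List ℕ) λ t → list S ≡ h ∷ t × RightmostPlus n h) →
                 Σ ℕ λ h → Σ (List ℕ) λ t → list S ≡ h ∷ t × RightmostPlus (suc n) h
    extend-top (h , t , eq , rightmost) =
      h , t , eq , rightmostPlus-extend rightmost (λ e′≡1 → contradiction (trans (sym e′) e′≡1) λ ())

  -- a minus entry empties the stack: just before it the stack holds only the rightmost plus,
  -- which the minus entry cancels
  survivors-minus : ∀ {n} → suc n ≤ s → F i (suc n) ≡ 0 → F (suc i) (suc n) ≡ 1 → e (suc n) ≡ -1ℤ →
                    Survivors n → Survivors (suc n)
  survivors-minus {n} 1+n≤s a b e′ S = record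
    { list       = []
    ; unique     = []
    ; complete   = λ j → mk⇔ (λ ()) (λ sv → ⊥-elim (extinct sv))
    ; length≡gap = sym gap-after
    ; top        = λ 0<gap → contradiction (subst (0 <_) gap-after 0<gap) λ ()
    }
    where
    gap-before : gap n ≡ 1
    gap-before = proj₁ (gap-minus 1+n≤s a b)

    gap-after : gap (suc n) ≡ 0
    gap-after = proj₂ (gap-minus 1+n≤s a b)

    only : Σ ℕ λ h → list S ≡ h ∷ [] × RightmostPlus n h
    only with top S (subst (0 <_) (sym gap-before) (s≤s z≤n))
    ... | h , []    , eq , rightmost = h , eq , rightmost
    ... | h , _ ∷ _ , eq , _ =
      contradiction (trans (cong length (sym eq)) (trans (length≡gap S) gap-before)) λ ()

    extinct : ∀ {j} → ¬ Surviving (suc n) j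
    extinct {j} sv@(_ , j≤1+n , ej , uncancelled) with m≤n⇒m<n∨m≡n j≤1+n
    ... | inj₂ refl  = contradiction (trans (sym e′) ej) λ ()
    ... | inj₁ j<1+n with only
    ...   | h , eq , (_ , h≤n , _ , last)
            with subst (j ∈_) eq (Equivalence.from (complete S j) (surviving-restrict sv (≤-pred j<1+n)))
    ...     | here refl = uncancelled (suc n , ≤-refl , e′ , s≤s h≤n ,
                            λ k h<k k<1+n → last k h<k (≤-pred k<1+n))

  survivors : ∀ {n} → n ≤ s → Survivors n
  survivors {zero}  _     = survivors-zero
  survivors {suc n} 1+n≤s with column (s≤s z≤n) 1+n≤s
  ... | plus  a b e′ = survivors-plus 1+n≤s a b e′ (survivors (<⇒≤ 1+n≤s))
  ... | minus a b e′ = survivors-minus 1+n≤s a b e′ (survivors (<⇒≤ 1+n≤s))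
  ... | flat  a e′   = survivors-flat a e′ (survivors (<⇒≤ 1+n≤s))

-- Sources of the KGR graph

last-one : ∀ {r x c} → ColumnRules r x c → ∀ {m} → x m ≡ 1 →
           Σ ℕ λ i₀ → m ≤ i₀ × i₀ ≤ r × x i₀ ≡ 1 × x (suc i₀) ≡ 0
last-one {r} {x} rules {m} xm≡1 = search r (m≤n+m r m) xm≡1
  where
  search : ∀ k {m} → r ≤ m + k → x m ≡ 1 → Σ ℕ λ i₀ → m ≤ i₀ × i₀ ≤ r × x i₀ ≡ 1 × x (suc i₀) ≡ 0
  search k {m} r≤m+k xm≡1 with binary rules (suc m)
  ... | inj₁ x′≡0 = m , ≤-refl , m≤r , xm≡1 , x′≡0
    where
    m≤r : m ≤ r
    m≤r = ≮⇒≥ λ r<m → contradiction (trans (sym xm≡1) (outside-zero rules r<m)) λ ()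
  search zero    {m} r≤m+0   _ | inj₂ x′≡1 = contradiction
    (trans (sym x′≡1) (outside-zero rules (s≤s (subst (r ≤_) (+-identityʳ m) r≤m+0)))) λ ()
  search (suc k) {m} r≤m+1+k _ | inj₂ x′≡1 with search k (subst (r ≤_) (+-suc m k) r≤m+1+k) x′≡1
  ... | i₀ , m<i₀ , rest = i₀ , <⇒≤ m<i₀ , rest

part-outside : ∀ {r} (v : Vec ℕ r) {i} → r < i → part v i ≡ 0
part-outside []       _           = refl
part-outside (x ∷ xs) {suc (suc i)} (s≤s r<i) = part-outside xs r<i

part≤head : ∀ {r} (v : Vec ℕ r) → IsPartition v → ∀ i → part v i ≤ part v 1
part≤head []      _ i = z≤n
part≤head (_ ∷ _) _ zero          = z≤n
part≤head (_ ∷ _) _ (suc zero)    = ≤-refl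
part≤head v       p (suc (suc i)) = ≤-trans (p i) (part≤head v p (suc i))

part-suc≤ : ∀ {r} (v : Vec ℕ r) → IsPartition v → ∀ {i} → 1 ≤ i → part v (suc i) ≤ part v i
part-suc≤ v p {suc i} _ = p i

initialMat-justified : ∀ {r} (mu : Vec ℕ r) {s} i → LeftJustified (initialMat mu) i s (part mu i)
initialMat-justified mu i = record
  { ones  = λ {q} 1≤q q≤c _ → cong indicator (reflects-true (entry-reflects q) (1≤q , s≤s q≤c))
  ; zeros = λ {q} c<q _ → cong indicator
              (reflects-false (entry-reflects q) λ (_ , q<1+c) → <⇒≱ c<q (≤-pred q<1+c))
  }
  where
  entry-reflects : ∀ q → Reflects (0 < q × q < suc (part mu i)) ((0 <ᵇ q) ∧ (q <ᵇ suc (part mu i)))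
  entry-reflects q = <ᵇ-reflects-< 0 q ×-reflects <ᵇ-reflects-< q _

module CanonicalMatrix (r : ℕ) (lam mu : Vec ℕ r) (K : Kostka r lam mu) where
  open RyserStep r lam

  s : ℕ
  s = ncols lam

  A : Mat
  A = ryserMatrix r lam mu

  mu≤s : ∀ i → part mu i ≤ s
  mu≤s i = ≤-trans (part≤head mu (proj₁ (proj₂ K)) i) (proj₂ (proj₂ (proj₂ K)) 1)

  loop : LoopResult s (initialMat mu) A
  loop = ryserLoop-result s (initialMat mu) λ i → record
    { count         = part mu i
    ; count≤        = mu≤s i
    ; justified     = initialMat-justified mu i
    ; outside-empty = part-outside mu
    }

  rules : ∀ {j} → 1 ≤ j → j ≤ s → ColumnRules r (λ i → A i j) (λ i → rowCount A i j)
  rules = LoopResult.rules loop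

  rowCount-A : ∀ i → rowCount A i s ≡ part mu i
  rowCount-A i = trans (LoopResult.count-preserved loop i)
                       (rowCount-full (mu≤s i) (initialMat-justified mu i))

  Astar-def : ∀ {i} → i ≤ r → ∀ {j} → 1 ≤ j → j ≤ s → Astar r lam mu i j ≡ + A i j - + A (suc i) j
  Astar-def {i} i≤r {j} 1≤j j≤s with i <ᵇ r in i<ᵇr
  ... | true  = refl
  ... | false
    rewrite outside-zero (rules 1≤j j≤s) (s≤s (≮⇒≥ (reflects-refute (<ᵇ-reflects-< i r) i<ᵇr))) =
    sym (ℤ.+-identityʳ (+ A i j))

  module Row {i} (1≤i : 1 ≤ i) (i≤r : i ≤ r) where
    open KGR r lam mu using (Vertex; Source)

    dominant : rowCount A (suc i) s ≤ rowCount A i s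
    dominant = subst₂ _≤_ (sym (rowCount-A (suc i))) (sym (rowCount-A i))
                 (part-suc≤ mu (proj₁ (proj₂ K)) 1≤i)

    open TwoRows r A i s 1≤i (Astar r lam mu i) (Astar-def i≤r) rules dominant

    -- a minus entry is always hit by a type (II) arc from the lowest one of its block of ones below
    source⇒plus : ∀ {j} → Source i j → Astar r lam mu i j ≡ + 1
    source⇒plus {j} ((_ , _ , 1≤j , j≤s , nonzero) , no-arc) with column 1≤j j≤s
    ... | plus _ _ e≡1 = e≡1
    ... | flat _ e≡0   = contradiction e≡0 nonzero
    ... | minus _ below≡1 e≡-1 with last-one (rules 1≤j j≤s) below≡1
    ...   | i₀ , 1+i≤i₀ , i₀≤r , one , zero′ =
      ⊥-elim (no-arc i₀ j (vertex₀ , (1≤i , i≤r , 1≤j , j≤s , nonzero) , inj₂ (refl , S≡1 , e≡-1)))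
      where
      S≡1 : Astar r lam mu i₀ j ≡ + 1
      S≡1 = trans (Astar-def i₀≤r 1≤j j≤s) (cong₂ (λ x y → + x - + y) one zero′)

      vertex₀ : Vertex i₀ j
      vertex₀ = ≤-trans (s≤s z≤n) 1+i≤i₀ , i₀≤r , 1≤j , j≤s ,
                λ S≡0 → contradiction (trans (sym S≡1) S≡0) λ ()

    surviving⇒source : ∀ {j} → Surviving s j → Source i j
    surviving⇒source {j} (1≤j , j≤s , e≡1 , uncancelled) = vertex , no-arc
      where
      vertex : Vertex i j
      vertex = 1≤i , i≤r , 1≤j , j≤s , λ e≡0 → contradiction (trans (sym e≡1) e≡0) λ ()

      no-arc : ∀ i₀ j₀ → ¬ KGR.Arc r lam mu i₀ j₀ i j
      no-arc i₀ j₀ ((_ , _ , _ , j₀≤s , _) , _ , inj₁ (refl , e₀≡-1 , j<j₀ , _ , clear)) =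
        uncancelled (j₀ , j₀≤s , e₀≡-1 , j<j₀ , clear)
      no-arc i₀ j₀ (_ , _ , inj₂ (refl , _ , e≡-1)) = contradiction (trans (sym e≡1) e≡-1) λ ()

    source⇒surviving : ∀ {j} → Source i j → Surviving s j
    source⇒surviving {j} src@(vertex@(_ , _ , 1≤j , j≤s , _) , no-arc) =
      1≤j , j≤s , source⇒plus src , λ (j₀ , j₀≤s , e₀≡-1 , j<j₀ , clear) →
        no-arc i j₀ ((1≤i , i≤r , ≤-trans (s≤s z≤n) j<j₀ , j₀≤s ,
                      λ e₀≡0 → contradiction (trans (sym e₀≡-1) e₀≡0) λ ()) ,
                     vertex , inj₁ (refl , e₀≡-1 , j<j₀ , source⇒plus src , clear))

    sources : Σ (List ℕ) λ js → Unique js × (∀ j → (j ∈ js) ⇔ Source i j) × length js ≡ starPart mu i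
    sources = list , unique ,
              (λ j → mk⇔ surviving⇒source source⇒surviving ⇔-∘ complete j) ,
              trans length≡gap (cong₂ _∸_ (rowCount-A i) (rowCount-A (suc i)))
      where open Survivors (survivors ≤-refl)

proposition2p21 : (r : ℕ) (lam mu : Vec ℕ r) → Kostka r lam mu →
    ∀ i → 1 ≤ i → i ≤ r →
      Σ (List ℕ) (λ js →
          Unique js × (∀ j → (j ∈ js) ⇔ KGR.Source r lam mu i j) ×
          length js ≡ starPart mu i)
      × (∀ j → KGR.Source r lam mu i j → Astar r lam mu i j ≡ + 1)
proposition2p21 r lam mu K i 1≤i i≤r = sources , λ _ → source⇒plus
  where open CanonicalMatrix.Row r lam mu K 1≤i i≤r
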